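{- Let $G$ be a graph. (i) If $v_1v_2v_3v_4v_5$ is a path in $G$ with $d(v_1)=d(v_5)=1$ and $d(v_2)=2$, then $G$ is not well-indumatched. (ii) If $v_1v_2v_3v_4v_5v_6$ is a path in $G$ with $d(v_1)=d(v_6)=1$ and $d(v_2)=d(v_5)=2$, then $G$ is not well-indumatched.
   Context: All graphs are finite, simple and undirected; $d(v)$ denotes the degree of $v$ in $G$. An induced matching of a graph $G$ is a set $M$ of edges, no two sharing an endpoint, such that no edge of $G$ joins an endpoint of one edge of $M$ to an endpoint of another edge of $M$. A graph is well-indumatched if all of its inclusion-wise maximal induced matchings have the same size. -}

module Defs where

open import Data.Nat using (ℕ)
open import Data.Bool using (Bool; true; false; if_then_else_)
open import Data.Fin using (Fin)
open import Data.List using (List; length; map; allFin; lookup)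
open import Data.Nat.ListAction using (sum)
open import Data.List.Relation.Unary.All using (All)
open import Data.List.Relation.Unary.Any using (Any)
open import Data.Product using (_×_; _,_; proj₁; proj₂)
open import Data.Sum using (_⊎_)
open import Relation.Binary.PropositionalEquality using (_≡_; _≢_)
open import Relation.Nullary using (¬_)

record Graph : Set where
  field
    n     : ℕ
    adj   : Fin n → Fin n → Bool
    sym   : ∀ u v → adj u v ≡ adj v u
    irrefl : ∀ v → adj v v ≡ false

open Graph public

Vertex : Graph → Set
Vertex G = Fin (n G)

Adj : (G : Graph) → Vertex G → Vertex G → Set
Adj G u v = adj G u v ≡ true

deg : (G : Graph) → Vertex G → ℕ
deg G v = sum (map (λ u → if adj G v u then 1 else 0) (allFin (n G)))

-- an edge is represented by an (oriented) pair of its endpoints;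
-- a set of edges by a list of such pairs
Edge : Graph → Set
Edge G = Vertex G × Vertex G

SameEdge : (G : Graph) → Edge G → Edge G → Set
SameEdge G (a , b) (c , d) = (a ≡ c × b ≡ d) ⊎ (a ≡ d × b ≡ c)

_∈E_ : {G : Graph} → Edge G → List (Edge G) → Set
_∈E_ {G} e M = Any (SameEdge G e) M

_⊆E_ : {G : Graph} → List (Edge G) → List (Edge G) → Set
_⊆E_ {G} M M' = All (λ e → _∈E_ {G} e M') M

Touch : (G : Graph) → Edge G → Edge G → Set
Touch G (a , b) (c , d) =
  (a ≡ c ⊎ a ≡ d ⊎ b ≡ c ⊎ b ≡ d) ⊎
  (Adj G a c ⊎ Adj G a d ⊎ Adj G b c ⊎ Adj G b d)

-- M is an induced matching: every element is an edge of G, and any two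
-- entries at distinct positions neither share an endpoint nor are joined
-- by an edge of G (in particular the list has no repeated edges, so its
-- length is the size of the matching)
IsInducedMatching : (G : Graph) → List (Edge G) → Set
IsInducedMatching G M =
  All (λ e → Adj G (proj₁ e) (proj₂ e)) M ×
  (∀ (i j : Fin (length M)) → i ≢ j → ¬ Touch G (lookup M i) (lookup M j))

IsMaximalInducedMatching : (G : Graph) → List (Edge G) → Set
IsMaximalInducedMatching G M =
  IsInducedMatching G M ×
  (∀ M' → IsInducedMatching G M' → _⊆E_ {G} M M' → _⊆E_ {G} M' M)

WellIndumatched : Graph → Set
WellIndumatched G =
  ∀ M M' → IsMaximalInducedMatching G M → IsMaximalInducedMatching G M' →
  length M ≡ length M'

-- Let e = v₃v₄. In both configurations the pendant pieces a = v₁v₂ and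
-- b = v₄v₅ (resp. v₅v₆) are disjoint, non-adjacent edges with the property that
-- every edge touching a or b already touches e. Extend {e} to a maximal induced
-- matching X ∪ {e}; then X ∪ {a, b} is an induced matching as well, and any
-- maximal extension of it is strictly larger than X ∪ {e}.
module Submission where

open import Defs hiding (sym)
open import Data.Bool using (Bool; true; false; if_then_else_)
import Data.Bool as Bool
open import Data.Empty using (⊥-elim)
open import Data.Fin using (Fin; _≟_)
open import Data.List using (List; []; _∷_; _++_; [_]; length; map; allFin; lookup; cartesianProduct)
open import Data.List.Properties using (length-++; ++-assoc)
open import Data.List.Membership.Propositional using (_∈_; lose; find)
open import Data.List.Membership.Propositional.Properties using (∈-allFin; ∈-lookup; ∈-cartesianProduct⁺)
open import Data.List.Relation.Unary.All as All using (All; []; _∷_)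
open import Data.List.Relation.Unary.All.Properties using (¬Any⇒All¬; ++⁻)
open import Data.List.Relation.Unary.AllPairs using (AllPairs; []; _∷_)
open import Data.List.Relation.Unary.Any using (Any; here; there; any?; index)
open import Data.List.Relation.Unary.Any.Properties using (lookup-index; ++⁺ʳ)
open import Data.List.Relation.Unary.Unique.Propositional using (Unique)
open import Data.Nat using (ℕ; suc; _+_; _≤_; z≤n; s≤s)
open import Data.Nat.ListAction using (sum)
open import Data.Nat.Properties using (≤-refl; ≤-trans; +-mono-≤; +-suc; +-comm; m≤n+m; 1+n≰n; module ≤-Reasoning)
open import Data.Product using (∃; _×_; _,_; proj₁; proj₂)
open import Data.Sum using (_⊎_; inj₁; inj₂; [_,_]′; swap)
open import Function using (_∘_; id)
open import Level using (0ℓ)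
open import Relation.Binary.Core using (Rel)
open import Relation.Binary.Definitions using (Symmetric)
open import Relation.Binary.PropositionalEquality using (_≡_; _≢_; refl; sym; trans; cong; subst)
open import Relation.Nullary using (¬_; Dec; yes; no; does)
open import Relation.Nullary.Decidable using (_⊎-dec_; _×-dec_; ¬?)

indicator : Bool → ℕ
indicator b = if b then 1 else 0

count : {n : ℕ} → (Fin n → Bool) → List (Fin n) → ℕ
count g xs = sum (map (λ u → indicator (g u)) xs)

clear : {n : ℕ} → Fin n → (Fin n → Bool) → Fin n → Bool
clear u g x = if does (x ≟ u) then false else g x

clear-≢ : {n : ℕ} (g : Fin n → Bool) {u x : Fin n} → x ≢ u → clear u g x ≡ g x
clear-≢ g {u} {x} x≢u with x ≟ u
... | yes x≡u = ⊥-elim (x≢u x≡u)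
... | no _ = refl

indicator-clear-≤ : {n : ℕ} (g : Fin n → Bool) (u x : Fin n) → indicator (clear u g x) ≤ indicator (g x)
indicator-clear-≤ g u x with x ≟ u
... | yes _ = z≤n
... | no _ = ≤-refl

count-clear-≤ : {n : ℕ} (g : Fin n → Bool) (u : Fin n) (xs : List (Fin n)) →
  count (clear u g) xs ≤ count g xs
count-clear-≤ g u [] = z≤n
count-clear-≤ g u (x ∷ xs) = +-mono-≤ (indicator-clear-≤ g u x) (count-clear-≤ g u xs)

count-clear-< : {n : ℕ} (g : Fin n → Bool) {u : Fin n} {xs : List (Fin n)} →
  g u ≡ true → u ∈ xs → suc (count (clear u g) xs) ≤ count g xs
count-clear-< g {u} {u ∷ xs} gu (here refl) with u ≟ u
... | no u≢u = ⊥-elim (u≢u refl)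
... | yes _ rewrite gu = s≤s (count-clear-≤ g u xs)
count-clear-< g {u} {x ∷ xs} gu (there u∈xs) =
  subst (_≤ count g (x ∷ xs)) (+-suc _ _)
        (+-mono-≤ (indicator-clear-≤ g u x) (count-clear-< g gu u∈xs))

length≤count : {n : ℕ} (g : Fin n → Bool) (ys : List (Fin n)) →
  Unique ys → All (λ y → g y ≡ true) ys → length ys ≤ count g (allFin n)
length≤count g [] _ _ = z≤n
length≤count g (y ∷ ys) (y∉ys ∷ ys!) (gy ∷ gys) =
  ≤-trans (s≤s (length≤count (clear y g) ys ys! cleared)) (count-clear-< g gy (∈-allFin y))
  where
  cleared : All (λ z → clear y g z ≡ true) ys
  cleared = All.zipWith (λ (y≢z , gz) → trans (clear-≢ g (y≢z ∘ sym)) gz) (y∉ys , gys)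

AllPairs-++⁻ : ∀ {A : Set} {R : Rel A 0ℓ} (xs : List A) {ys : List A} →
  AllPairs R (xs ++ ys) → AllPairs R xs × AllPairs R ys × All (λ x → All (R x) ys) xs
AllPairs-++⁻ [] Rys = [] , Rys , []
AllPairs-++⁻ (x ∷ xs) (Rx ∷ Rxsys) with AllPairs-++⁻ xs Rxsys | ++⁻ xs Rx
... | Rxs , Rys , Rxsys′ | Rx-xs , Rx-ys = (Rx-xs ∷ Rxs) , Rys , (Rx-ys ∷ Rxsys′)

AllPairs-lookup : ∀ {A : Set} {R : Rel A 0ℓ} → Symmetric R → {xs : List A} → AllPairs R xs →
  ∀ i j → i ≢ j → R (lookup xs i) (lookup xs j)
AllPairs-lookup R-sym (Rx ∷ Rxs) Fin.zero Fin.zero 0≢0 = ⊥-elim (0≢0 refl)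
AllPairs-lookup R-sym (Rx ∷ Rxs) Fin.zero (Fin.suc j) _ = All.lookup Rx (∈-lookup j)
AllPairs-lookup R-sym (Rx ∷ Rxs) (Fin.suc i) Fin.zero _ = R-sym (All.lookup Rx (∈-lookup i))
AllPairs-lookup R-sym (Rx ∷ Rxs) (Fin.suc i) (Fin.suc j) i≢j =
  AllPairs-lookup R-sym Rxs i j (i≢j ∘ cong Fin.suc)

module GraphFacts (G : Graph) where

  adj-sym : ∀ {x y} → Adj G x y → Adj G y x
  adj-sym {x} {y} xy = trans (Graph.sym G y x) xy

  distinct-neighbours≤deg : ∀ {v} (us : List (Vertex G)) → Unique us → All (Adj G v) us →
    length us ≤ deg G v
  distinct-neighbours≤deg {v} = length≤count (adj G v)

  deg≡1⇒neighbour-unique : ∀ {v u w} → deg G v ≡ 1 → Adj G v u → Adj G v w → w ≡ u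
  deg≡1⇒neighbour-unique {v} {u} {w} dv vu vw with w ≟ u
  ... | yes w≡u = w≡u
  ... | no w≢u = ⊥-elim (1+n≰n (subst (2 ≤_) dv
        (distinct-neighbours≤deg (w ∷ u ∷ []) ((w≢u ∷ []) ∷ [] ∷ []) (vw ∷ vu ∷ []))))

  deg≡2⇒neighbours : ∀ {v a b w} → deg G v ≡ 2 → Adj G v a → Adj G v b → a ≢ b →
    Adj G v w → w ≡ a ⊎ w ≡ b
  deg≡2⇒neighbours {v} {a} {b} {w} dv va vb a≢b vw with w ≟ a | w ≟ b
  ... | yes w≡a | _ = inj₁ w≡a
  ... | no _ | yes w≡b = inj₂ w≡b
  ... | no w≢a | no w≢b = ⊥-elim (1+n≰n (subst (3 ≤_) dv
        (distinct-neighbours≤deg (w ∷ a ∷ b ∷ [])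
          ((w≢a ∷ w≢b ∷ []) ∷ (a≢b ∷ []) ∷ [] ∷ []) (vw ∷ va ∷ vb ∷ []))))

  IsEdge : Edge G → Set
  IsEdge (x , y) = Adj G x y

  Near : Vertex G → Vertex G → Set
  Near x r = x ≡ r ⊎ Adj G x r

  EdgeNear : Edge G → Vertex G → Set
  EdgeNear (x , y) r = Near x r ⊎ Near y r

  touch⇒near : ∀ {e c d} → Touch G e (c , d) → EdgeNear e c ⊎ EdgeNear e d
  touch⇒near (inj₁ (inj₁ x≡c)) = inj₁ (inj₁ (inj₁ x≡c))
  touch⇒near (inj₁ (inj₂ (inj₁ x≡d))) = inj₂ (inj₁ (inj₁ x≡d))
  touch⇒near (inj₁ (inj₂ (inj₂ (inj₁ y≡c)))) = inj₁ (inj₂ (inj₁ y≡c))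
  touch⇒near (inj₁ (inj₂ (inj₂ (inj₂ y≡d)))) = inj₂ (inj₂ (inj₁ y≡d))
  touch⇒near (inj₂ (inj₁ xc)) = inj₁ (inj₁ (inj₂ xc))
  touch⇒near (inj₂ (inj₂ (inj₁ xd))) = inj₂ (inj₁ (inj₂ xd))
  touch⇒near (inj₂ (inj₂ (inj₂ (inj₁ yc)))) = inj₁ (inj₂ (inj₂ yc))
  touch⇒near (inj₂ (inj₂ (inj₂ (inj₂ yd)))) = inj₂ (inj₂ (inj₂ yd))

  near⇒touchˡ : ∀ {e c d} → EdgeNear e c → Touch G e (c , d)
  near⇒touchˡ (inj₁ (inj₁ x≡c)) = inj₁ (inj₁ x≡c)
  near⇒touchˡ (inj₁ (inj₂ xc)) = inj₂ (inj₁ xc)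
  near⇒touchˡ (inj₂ (inj₁ y≡c)) = inj₁ (inj₂ (inj₂ (inj₁ y≡c)))
  near⇒touchˡ (inj₂ (inj₂ yc)) = inj₂ (inj₂ (inj₂ (inj₁ yc)))

  near⇒touchʳ : ∀ {e c d} → EdgeNear e d → Touch G e (c , d)
  near⇒touchʳ (inj₁ (inj₁ x≡d)) = inj₁ (inj₂ (inj₁ x≡d))
  near⇒touchʳ (inj₁ (inj₂ xd)) = inj₂ (inj₂ (inj₁ xd))
  near⇒touchʳ (inj₂ (inj₁ y≡d)) = inj₁ (inj₂ (inj₂ (inj₂ y≡d)))
  near⇒touchʳ (inj₂ (inj₂ yd)) = inj₂ (inj₂ (inj₂ (inj₂ yd)))

  touch-swapʳ : ∀ {e c d} → Touch G e (c , d) → Touch G e (d , c)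
  touch-swapʳ = [ near⇒touchʳ , near⇒touchˡ ]′ ∘ touch⇒near

  touch-sym : ∀ {e f} → Touch G e f → Touch G f e
  touch-sym (inj₁ (inj₁ p)) = inj₁ (inj₁ (sym p))
  touch-sym (inj₁ (inj₂ (inj₁ p))) = inj₁ (inj₂ (inj₂ (inj₁ (sym p))))
  touch-sym (inj₁ (inj₂ (inj₂ (inj₁ p)))) = inj₁ (inj₂ (inj₁ (sym p)))
  touch-sym (inj₁ (inj₂ (inj₂ (inj₂ p)))) = inj₁ (inj₂ (inj₂ (inj₂ (sym p))))
  touch-sym (inj₂ (inj₁ p)) = inj₂ (inj₁ (adj-sym p))
  touch-sym (inj₂ (inj₂ (inj₁ p))) = inj₂ (inj₂ (inj₂ (inj₁ (adj-sym p))))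
  touch-sym (inj₂ (inj₂ (inj₂ (inj₁ p)))) = inj₂ (inj₂ (inj₁ (adj-sym p)))
  touch-sym (inj₂ (inj₂ (inj₂ (inj₂ p)))) = inj₂ (inj₂ (inj₂ (inj₂ (adj-sym p))))

  touch-refl : ∀ {e} → Touch G e e
  touch-refl = inj₁ (inj₁ refl)

  touch? : ∀ e f → Dec (Touch G e f)
  touch? (a , b) (c , d) = (a ≟ c ⊎-dec a ≟ d ⊎-dec b ≟ c ⊎-dec b ≟ d) ⊎-dec
    (adj G a c Bool.≟ true ⊎-dec adj G a d Bool.≟ true ⊎-dec
     adj G b c Bool.≟ true ⊎-dec adj G b d Bool.≟ true)

  same-sym : ∀ {e f} → SameEdge G e f → SameEdge G f e
  same-sym (inj₁ (p , q)) = inj₁ (sym p , sym q)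
  same-sym (inj₂ (p , q)) = inj₂ (sym q , sym p)

  touch-same : ∀ {e f g} → Touch G e f → SameEdge G f g → Touch G e g
  touch-same t (inj₁ (refl , refl)) = t
  touch-same t (inj₂ (refl , refl)) = touch-swapʳ t

  leaf-near : ∀ {s r x y} → deg G s ≡ 1 → Adj G s r → Adj G x y → Near x s → Near x r ⊎ Near y r
  leaf-near ds sr xy (inj₁ refl) = inj₂ (inj₁ (deg≡1⇒neighbour-unique ds sr xy))
  leaf-near ds sr xy (inj₂ xs) = inj₁ (inj₁ (deg≡1⇒neighbour-unique ds sr (adj-sym xs)))

  leaf-edgeNear : ∀ {s r e} → deg G s ≡ 1 → Adj G s r → IsEdge e → EdgeNear e s → EdgeNear e r
  leaf-edgeNear ds sr xy (inj₁ xs) = leaf-near ds sr xy xs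
  leaf-edgeNear ds sr xy (inj₂ ys) = swap (leaf-near ds sr (adj-sym xy) ys)

  pendant-near : ∀ {p q r x y} → deg G p ≡ 1 → deg G q ≡ 2 → Adj G p q → Adj G q r → p ≢ r →
    Adj G x y → Near x q → Near x r ⊎ Near y r
  pendant-near dp dq pq qr p≢r xy (inj₁ refl) = inj₁ (inj₂ qr)
  pendant-near dp dq pq qr p≢r xy (inj₂ xq) with deg≡2⇒neighbours dq (adj-sym pq) qr p≢r (adj-sym xq)
  ... | inj₁ refl = inj₂ (inj₂ (subst (λ z → Adj G z _) (sym (deg≡1⇒neighbour-unique dp pq xy)) qr))
  ... | inj₂ refl = inj₁ (inj₁ refl)

  pendant-edgeNear : ∀ {p q r e} → deg G p ≡ 1 → deg G q ≡ 2 → Adj G p q → Adj G q r → p ≢ r →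
    IsEdge e → EdgeNear e q → EdgeNear e r
  pendant-edgeNear dp dq pq qr p≢r xy (inj₁ xq) = pendant-near dp dq pq qr p≢r xy xq
  pendant-edgeNear dp dq pq qr p≢r xy (inj₂ yq) = swap (pendant-near dp dq pq qr p≢r (adj-sym xy) yq)

  touch-leaf : ∀ {s r f} → deg G s ≡ 1 → Adj G s r → IsEdge f → Touch G f (r , s) → EdgeNear f r
  touch-leaf ds sr fE = [ id , leaf-edgeNear ds sr fE ]′ ∘ touch⇒near

  touch-pendant : ∀ {p q r f} → deg G p ≡ 1 → deg G q ≡ 2 → Adj G p q → Adj G q r → p ≢ r →
    IsEdge f → Touch G f (p , q) → EdgeNear f r
  touch-pendant dp dq pq qr p≢r fE =
    pendant-edgeNear dp dq pq qr p≢r fE ∘ [ leaf-edgeNear dp pq fE , id ]′ ∘ touch⇒near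

  pendant-far : ∀ {p q r w} → deg G p ≡ 1 → deg G q ≡ 2 → Adj G p q → Adj G q r → p ≢ r →
    w ≢ p → w ≢ q → w ≢ r → ¬ EdgeNear (p , q) w
  pendant-far dp dq pq qr p≢r w≢p w≢q w≢r (inj₁ (inj₁ p≡w)) = w≢p (sym p≡w)
  pendant-far dp dq pq qr p≢r w≢p w≢q w≢r (inj₁ (inj₂ pw)) = w≢q (deg≡1⇒neighbour-unique dp pq pw)
  pendant-far dp dq pq qr p≢r w≢p w≢q w≢r (inj₂ (inj₁ q≡w)) = w≢q (sym q≡w)
  pendant-far dp dq pq qr p≢r w≢p w≢q w≢r (inj₂ (inj₂ qw)) =
    [ w≢p , w≢r ]′ (deg≡2⇒neighbours dq (adj-sym pq) qr p≢r qw)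

  -- IsInducedMatching with the pairwise condition as AllPairs, so that it is built up by consing.
  IsInducedMatching′ : List (Edge G) → Set
  IsInducedMatching′ M = All IsEdge M × AllPairs (λ e f → ¬ Touch G e f) M

  IsInducedMatching′⇒IsInducedMatching : ∀ {M} → IsInducedMatching′ M → IsInducedMatching G M
  IsInducedMatching′⇒IsInducedMatching (edges , apart) =
    (edges , AllPairs-lookup (λ ¬t → ¬t ∘ touch-sym) apart)

  induced-touch⇒same : ∀ {M x f} → IsInducedMatching G M → x ∈ M → _∈E_ {G} f M →
    Touch G x f → SameEdge G x f
  induced-touch⇒same {M} (_ , apart) x∈M f∈M t with index x∈M ≟ index f∈M
  ... | yes i≡j = same-sym (subst (SameEdge G _) (sym x≡Mj) (lookup-index f∈M))
    where
    x≡Mj : _ ≡ lookup M (index f∈M)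
    x≡Mj = trans (lookup-index x∈M) (cong (lookup M) i≡j)
  ... | no i≢j = ⊥-elim (apart (index x∈M) (index f∈M) i≢j
    (subst (λ z → Touch G z _) (lookup-index x∈M) (touch-same t (lookup-index f∈M))))

  touching-all⇒maximal : ∀ {M} → IsInducedMatching G M →
    (∀ f → IsEdge f → Any (Touch G f) M) → IsMaximalInducedMatching G M
  touching-all⇒maximal {M} im touching = im , maximal
    where
    maximal : ∀ M′ → IsInducedMatching G M′ → _⊆E_ {G} M M′ → _⊆E_ {G} M′ M
    maximal M′ im′ M⊆M′ = All.tabulate absorbed
      where
      absorbed : ∀ {x} → x ∈ M′ → _∈E_ {G} x M
      absorbed {x} x∈M′ with find (touching x (subst IsEdge (sym (lookup-index x∈M′))
                                                  (All.lookup (proj₁ im′) (∈-lookup (index x∈M′)))))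
      ... | f , f∈M , t = lose f∈M (induced-touch⇒same im′ x∈M′ (All.lookup M⊆M′ f∈M) t)

  Addable : List (Edge G) → Edge G → Set
  Addable M f = IsEdge f × ¬ Any (Touch G f) M

  addable? : ∀ M f → Dec (Addable M f)
  addable? M (x , y) = (adj G x y Bool.≟ true) ×-dec ¬? (any? (touch? (x , y)) M)

  greedy : List (Edge G) → List (Edge G) → List (Edge G)
  greedy M [] = M
  greedy M (f ∷ fs) with addable? M f
  ... | yes _ = greedy (f ∷ M) fs
  ... | no _ = greedy M fs

  greedy-extends : ∀ M fs → ∃ λ X → greedy M fs ≡ X ++ M
  greedy-extends M [] = [] , refl
  greedy-extends M (f ∷ fs) with addable? M f
  ... | no _ = greedy-extends M fs
  ... | yes _ with greedy-extends (f ∷ M) fs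
  ...   | X , eq = X ++ [ f ] , trans eq (sym (++-assoc X [ f ] M))

  greedy-induced : ∀ M fs → IsInducedMatching′ M → IsInducedMatching′ (greedy M fs)
  greedy-induced M [] im = im
  greedy-induced M (f ∷ fs) (edges , apart) with addable? M f
  ... | yes (fE , free) = greedy-induced (f ∷ M) fs (fE ∷ edges , ¬Any⇒All¬ M free ∷ apart)
  ... | no _ = greedy-induced M fs (edges , apart)

  greedy-keeps : ∀ M fs {P : Edge G → Set} → Any P M → Any P (greedy M fs)
  greedy-keeps M fs {P} p with greedy-extends M fs
  ... | X , eq = subst (Any P) (sym eq) (++⁺ʳ X p)

  greedy-touching : ∀ M fs {f} → f ∈ fs → IsEdge f → Any (Touch G f) (greedy M fs)
  greedy-touching M (g ∷ fs) (there f∈fs) fE with addable? M g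
  ... | yes _ = greedy-touching (g ∷ M) fs f∈fs fE
  ... | no _ = greedy-touching M fs f∈fs fE
  greedy-touching M (f ∷ fs) (here refl) fE with addable? M f
  ... | yes _ = greedy-keeps (f ∷ M) fs (here touch-refl)
  ... | no ¬addable with any? (touch? f) M
  ...   | yes t = greedy-keeps M fs t
  ...   | no free = ⊥-elim (¬addable (fE , free))

  allPairs : List (Edge G)
  allPairs = cartesianProduct (allFin (n G)) (allFin (n G))

  ∈-allPairs : ∀ (f : Edge G) → f ∈ allPairs
  ∈-allPairs (x , y) = ∈-cartesianProduct⁺ (∈-allFin x) (∈-allFin y)

  extend-maximal : ∀ {M} → IsInducedMatching′ M →
    ∃ λ X → IsInducedMatching′ (X ++ M) × IsMaximalInducedMatching G (X ++ M)
  extend-maximal {M} im with greedy-extends M allPairs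
  ... | X , eq = X , im′ , touching-all⇒maximal (IsInducedMatching′⇒IsInducedMatching im′) touching
    where
    im′ : IsInducedMatching′ (X ++ M)
    im′ = subst IsInducedMatching′ eq (greedy-induced M allPairs im)
    touching : ∀ f → IsEdge f → Any (Touch G f) (X ++ M)
    touching f fE = subst (Any (Touch G f)) eq (greedy-touching M allPairs (∈-allPairs f) fE)

  Shadowed : Edge G → Edge G → Set
  Shadowed a e = ∀ {f} → IsEdge f → Touch G f a → Touch G f e

  replace-edge : ∀ {X e a b} → IsInducedMatching′ (X ++ [ e ]) →
    IsEdge a → IsEdge b → ¬ Touch G a b → Shadowed a e → Shadowed b e →
    IsInducedMatching′ (a ∷ b ∷ X)
  replace-edge {X} {e} (edges , apart) aE bE ¬ab a≺e b≺e
    with ++⁻ X edges | AllPairs-++⁻ X apart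
  ... | edgesX , _ | apartX , _ , apart-e =
    (aE ∷ bE ∷ edgesX) , ((¬ab ∷ apartFrom a≺e) ∷ apartFrom b≺e ∷ apartX)
    where
    apartFrom : ∀ {c} → Shadowed c e → All (λ f → ¬ Touch G c f) X
    apartFrom c≺e = All.zipWith (λ (fE , ¬f-e) ca → All.head ¬f-e (c≺e fE (touch-sym ca)))
                                (edgesX , apart-e)

  pendant-shadowed : ∀ {p q r t} → deg G p ≡ 1 → deg G q ≡ 2 → Adj G p q → Adj G q r → p ≢ r →
    Shadowed (p , q) (r , t)
  pendant-shadowed dp dq pq qr p≢r fE = near⇒touchˡ ∘ touch-pendant dp dq pq qr p≢r fE

  replaceable⇒¬WellIndumatched : ∀ {e a b} → IsEdge e → IsEdge a → IsEdge b → ¬ Touch G a b →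
    Shadowed a e → Shadowed b e → ¬ WellIndumatched G
  replaceable⇒¬WellIndumatched {e} {a} {b} eE aE bE ¬ab a≺e b≺e wi
    with extend-maximal {[ e ]} (eE ∷ [] , [] ∷ [])
  ... | X , imX , maxX with extend-maximal (replace-edge imX aE bE ¬ab a≺e b≺e)
  ...   | Y , _ , maxY = 1+n≰n (begin
      suc (suc (length X))            ≤⟨ m≤n+m _ (length Y) ⟩
      length Y + length (a ∷ b ∷ X)   ≡⟨ length-++ Y ⟨
      length (Y ++ a ∷ b ∷ X)         ≡⟨ wi _ _ maxX maxY ⟨
      length (X ++ [ e ])             ≡⟨ length-++ X ⟩
      length X + 1                    ≡⟨ +-comm (length X) 1 ⟩
      suc (length X)                  ∎)
    where open ≤-Reasoning

  pendant-path₅⇒¬WellIndumatched : ∀ {v₁ v₂ v₃ v₄ v₅} →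
    v₁ ≢ v₃ → v₁ ≢ v₄ → v₂ ≢ v₄ → v₃ ≢ v₄ →
    Adj G v₁ v₂ → Adj G v₂ v₃ → Adj G v₃ v₄ → Adj G v₄ v₅ →
    deg G v₁ ≡ 1 → deg G v₅ ≡ 1 → deg G v₂ ≡ 2 → ¬ WellIndumatched G
  pendant-path₅⇒¬WellIndumatched {v₁} {v₂} {v₃} {v₄} {v₅} n13 n14 n24 n34 a12 a23 a34 a45 d1 d5 d2 =
    replaceable⇒¬WellIndumatched a34 a12 a45 a∦b (pendant-shadowed d1 d2 a12 a23 n13) b≺e
    where
    b-near-v₄ : ∀ {f} → IsEdge f → Touch G f (v₄ , v₅) → EdgeNear f v₄
    b-near-v₄ = touch-leaf d5 (adj-sym a45)
    b≺e : Shadowed (v₄ , v₅) (v₃ , v₄)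
    b≺e fE = near⇒touchʳ ∘ b-near-v₄ fE
    a∦b : ¬ Touch G (v₁ , v₂) (v₄ , v₅)
    a∦b = pendant-far d1 d2 a12 a23 n13 (n14 ∘ sym) (n24 ∘ sym) (n34 ∘ sym) ∘ b-near-v₄ a12

  pendant-path₆⇒¬WellIndumatched : ∀ {v₁ v₂ v₃ v₄ v₅ v₆} →
    v₁ ≢ v₃ → v₁ ≢ v₄ → v₂ ≢ v₄ → v₃ ≢ v₄ → v₄ ≢ v₆ →
    Adj G v₁ v₂ → Adj G v₂ v₃ → Adj G v₃ v₄ → Adj G v₄ v₅ → Adj G v₅ v₆ →
    deg G v₁ ≡ 1 → deg G v₆ ≡ 1 → deg G v₂ ≡ 2 → deg G v₅ ≡ 2 → ¬ WellIndumatched G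
  pendant-path₆⇒¬WellIndumatched {v₁} {v₂} {v₃} {v₄} {v₅} {v₆} n13 n14 n24 n34 n46
                                  a12 a23 a34 a45 a56 d1 d6 d2 d5 =
    replaceable⇒¬WellIndumatched a34 a12 a56 a∦b (pendant-shadowed d1 d2 a12 a23 n13) b≺e
    where
    b-near-v₄ : ∀ {f} → IsEdge f → Touch G f (v₅ , v₆) → EdgeNear f v₄
    b-near-v₄ fE = touch-pendant d6 d5 (adj-sym a56) (adj-sym a45) (n46 ∘ sym) fE ∘ touch-swapʳ
    b≺e : Shadowed (v₅ , v₆) (v₃ , v₄)
    b≺e fE = near⇒touchʳ ∘ b-near-v₄ fE
    a∦b : ¬ Touch G (v₁ , v₂) (v₅ , v₆)
    a∦b = pendant-far d1 d2 a12 a23 n13 (n14 ∘ sym) (n24 ∘ sym) (n34 ∘ sym) ∘ b-near-v₄ a12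

lemma3p4 : (G : Graph) →
    ((v₁ v₂ v₃ v₄ v₅ : Vertex G) →
      v₁ ≢ v₂ → v₁ ≢ v₃ → v₁ ≢ v₄ → v₁ ≢ v₅ →
      v₂ ≢ v₃ → v₂ ≢ v₄ → v₂ ≢ v₅ →
      v₃ ≢ v₄ → v₃ ≢ v₅ →
      v₄ ≢ v₅ →
      Adj G v₁ v₂ → Adj G v₂ v₃ → Adj G v₃ v₄ → Adj G v₄ v₅ →
      deg G v₁ ≡ 1 → deg G v₅ ≡ 1 → deg G v₂ ≡ 2 →
      ¬ WellIndumatched G)
    ×
    ((v₁ v₂ v₃ v₄ v₅ v₆ : Vertex G) →
      v₁ ≢ v₂ → v₁ ≢ v₃ → v₁ ≢ v₄ → v₁ ≢ v₅ → v₁ ≢ v₆ →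
      v₂ ≢ v₃ → v₂ ≢ v₄ → v₂ ≢ v₅ → v₂ ≢ v₆ →
      v₃ ≢ v₄ → v₃ ≢ v₅ → v₃ ≢ v₆ →
      v₄ ≢ v₅ → v₄ ≢ v₆ →
      v₅ ≢ v₆ →
      Adj G v₁ v₂ → Adj G v₂ v₃ → Adj G v₃ v₄ → Adj G v₄ v₅ → Adj G v₅ v₆ →
      deg G v₁ ≡ 1 → deg G v₆ ≡ 1 → deg G v₂ ≡ 2 → deg G v₅ ≡ 2 →
      ¬ WellIndumatched G)
lemma3p4 G =
  (λ _ _ _ _ _ _ v₁≢v₃ v₁≢v₄ _ _ v₂≢v₄ _ v₃≢v₄ _ _ →
     pendant-path₅⇒¬WellIndumatched v₁≢v₃ v₁≢v₄ v₂≢v₄ v₃≢v₄) ,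
  (λ _ _ _ _ _ _ _ v₁≢v₃ v₁≢v₄ _ _ _ v₂≢v₄ _ _ v₃≢v₄ _ _ _ v₄≢v₆ _ →
     pendant-path₆⇒¬WellIndumatched v₁≢v₃ v₁≢v₄ v₂≢v₄ v₃≢v₄ v₄≢v₆)
  where open GraphFacts G
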